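{- Let $n\ge1$, let $0 = W_0 < W_1 < \cdots < W_n$ be real numbers, and let $B = [0,W_1]\times\cdots\times[0,W_n]$. For $\pi \in S_n$ let $C_{\pi} = \{x \in B : x_{\pi(1)} \geq \cdots \geq x_{\pi(n)}\}$. For $\rho = (\rho_1,\ldots,\rho_n) \in \{1,\ldots,n\}^n$ let $B_{\rho} = (W_{\rho_1-1}, W_{\rho_1}) \times \cdots \times (W_{\rho_n-1}, W_{\rho_n})$. Given $\rho$ and $\pi$, define $\lambda = (\lambda_1,\ldots,\lambda_n)$ by $\lambda_i = \rho_{\pi(i)}$. Then $C_{\pi} \cap B_{\rho} \neq \emptyset$ if and only if $\lambda_1 \geq \lambda_2 \geq \cdots \geq \lambda_n$ (i.e. $\lambda$ is a partition) and $\lambda_i \leq \pi(i)$ for all $1 \le i \le n$. -}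

module Defs where

open import Level using (Level; _⊔_)
open import Data.Nat using (ℕ)
import Data.Nat as N
open import Data.Fin using (Fin; zero; suc; inject₁)
import Data.Fin as F
open import Data.Fin.Permutation using (Permutation′; _⟨$⟩ʳ_)
open import Data.Product using (Σ; _×_)
open import Data.Sum using (_⊎_)
open import Relation.Binary.Bundles using (DenseLinearOrder)

-- Everything is stated over an arbitrary dense linear order O (ℝ with its
-- usual < is an instance).  Coordinates are indexed by Fin n: index j stands
-- for the paper's coordinate j+1.  W : Fin (suc n) → Carrier, W k = W_k.
module Setup {c ℓ₁ ℓ₂ : Level} (O : DenseLinearOrder c ℓ₁ ℓ₂) where
  open DenseLinearOrder O

  _≤_ : Carrier → Carrier → Set (ℓ₁ ⊔ ℓ₂)
  x ≤ y = (x < y) ⊎ (x ≈ y)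

  StrictlyIncreasing : {n : ℕ} → (Fin (N.suc n) → Carrier) → Set ℓ₂
  StrictlyIncreasing {n} W = ∀ (i j : Fin (N.suc n)) → i F.< j → W i < W j

  -- x ∈ B = [W_0, W_1] × ... × [W_0, W_n]   (W_0 plays the role of 0)
  InBox : {n : ℕ} → (Fin (N.suc n) → Carrier) → (Fin n → Carrier) → Set (ℓ₁ ⊔ ℓ₂)
  InBox W x = ∀ j → (W zero ≤ x j) × (x j ≤ W (suc j))

  InChamber : {n : ℕ} → Permutation′ n → (Fin n → Carrier) → Set (ℓ₁ ⊔ ℓ₂)
  InChamber π x = ∀ i j → i F.≤ j → x (π ⟨$⟩ʳ j) ≤ x (π ⟨$⟩ʳ i)

  -- x ∈ B_ρ ; ρ j : Fin n encodes the value ρ_{j+1} = toℕ (ρ j) + 1,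
  -- so the interval is (W_{ρ_j - 1}, W_{ρ_j}) = (W (inject₁ (ρ j)), W (suc (ρ j)))
  InCell : {n : ℕ} → (Fin (N.suc n) → Carrier) → (Fin n → Fin n) → (Fin n → Carrier) → Set ℓ₂
  InCell W ρ x = ∀ j → (W (inject₁ (ρ j)) < x j) × (x j < W (suc (ρ j)))

  Meets : {n : ℕ} → (Fin (N.suc n) → Carrier) → Permutation′ n → (Fin n → Fin n) → Set (c ⊔ ℓ₁ ⊔ ℓ₂)
  Meets {n} W π ρ = Σ (Fin n → Carrier) (λ x → InBox W x × InChamber π x × InCell W ρ x)

lam : {n : ℕ} → (Fin n → Fin n) → Permutation′ n → Fin n → Fin n
lam ρ π i = ρ (π ⟨$⟩ʳ i)

IsPartition : {n : ℕ} → (Fin n → Fin n) → Set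
IsPartition λ′ = ∀ i j → i F.≤ j → λ′ j F.≤ λ′ i

-- The open cells (W_{k-1}, W_k) are pairwise disjoint intervals ordered like their
-- indices k.  Hence along a chamber, where the coordinates x_{π(i)} decrease weakly,
-- the cell indices λ_i = ρ_{π(i)} must decrease weakly too, and x_j ≤ W_j forces
-- ρ_j ≤ j.  Conversely, density gives a point m_k in every cell; k ↦ m_k is monotone,
-- so x_j = m_{ρ_j} lies in the chamber, in the cell, and (by ρ_j ≤ j) in the box.
module Submission where

open import Level using (Level)
open import Data.Nat using (ℕ; suc; z≤n; s≤s)
import Data.Nat as N
import Data.Nat.Properties as NP
open import Data.Fin using (Fin; zero; inject₁; toℕ)
import Data.Fin as F
import Data.Fin.Properties as FP
open import Data.Fin.Permutation using (Permutation′; _⟨$⟩ʳ_; _⟨$⟩ˡ_; inverseʳ)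
open import Data.Product using (Σ; _×_; _,_; proj₁; proj₂)
open import Data.Sum using (inj₁; inj₂)
open import Function.Bundles using (_⇔_; mk⇔)
open import Relation.Binary.Bundles using (DenseLinearOrder)
open import Relation.Binary.PropositionalEquality using (refl; subst; sym)
open import Relation.Nullary using (¬_; yes; no)
open import Relation.Nullary.Negation using (contradiction)

open import Defs

permute-∀ : ∀ {n p} (π : Permutation′ n) {P : Fin n → Set p} →
            (∀ i → P (π ⟨$⟩ʳ i)) → ∀ j → P j
permute-∀ π {P} P∘π j = subst P (inverseʳ π) (P∘π (π ⟨$⟩ˡ j))

suc≤inject₁ : ∀ {n} {a b : Fin n} → a F.< b → F.suc a F.≤ inject₁ b
suc≤inject₁ {b = b} a<b = subst (suc (toℕ _) N.≤_) (sym (FP.toℕ-inject₁ b)) a<b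

module Cells {c ℓ₁ ℓ₂ : Level} (O : DenseLinearOrder c ℓ₁ ℓ₂) where
  open DenseLinearOrder O
  open Setup O
  import Relation.Binary.Construct.StrictToNonStrict _≈_ _<_ as NonStrict

  <-≤-trans : ∀ {x y z} → x < y → y ≤ z → x < z
  <-≤-trans = NonStrict.<-≤-trans trans (proj₁ <-resp-≈)

  ≤-<-trans : ∀ {x y z} → x ≤ y → y < z → x < z
  ≤-<-trans = NonStrict.≤-<-trans Eq.sym trans (proj₂ <-resp-≈)

  <⇒≱ : ∀ {x y} → x < y → ¬ (y ≤ x)
  <⇒≱ x<y (inj₁ y<x) = asym x<y y<x
  <⇒≱ x<y (inj₂ y≈x) = irrefl (Eq.sym y≈x) x<y

  module _ {n : ℕ} (W : Fin (suc n) → Carrier) (W-increasing : StrictlyIncreasing W) where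

    W-monotone : ∀ {i j} → i F.≤ j → W i ≤ W j
    W-monotone {i} {j} i≤j with i F.≟ j
    ... | yes refl = inj₂ Eq.refl
    ... | no i≢j   = inj₁ (W-increasing i j (FP.≤∧≢⇒< i≤j i≢j))

    Cell : Fin n → Carrier → Set ℓ₂
    Cell k x = W (inject₁ k) < x × x < W (F.suc k)

    cell-above : ∀ {j a x} → j F.< a → Cell a x → W (F.suc j) < x
    cell-above j<a (W<x , _) = ≤-<-trans (W-monotone (suc≤inject₁ j<a)) W<x

    cell-index-≤ : ∀ {a b x y} → Cell a x → Cell b y → y ≤ x → b F.≤ a
    cell-index-≤ {a} {b} (_ , x<W) y-cell y≤x with b FP.≤? a
    ... | yes b≤a = b≤a
    ... | no b≰a  = contradiction y≤x (<⇒≱ (trans x<W (cell-above (NP.≰⇒> b≰a) y-cell)))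

    cell-index-bounded : ∀ {a j x} → Cell a x → x ≤ W (F.suc j) → a F.≤ j
    cell-index-bounded {a} {j} x-cell x≤W with a FP.≤? j
    ... | yes a≤j = a≤j
    ... | no a≰j  = contradiction x≤W (<⇒≱ (cell-above (NP.≰⇒> a≰j) x-cell))

    cell-in-box : ∀ {a j x} → Cell a x → a F.≤ j → W zero ≤ x × x ≤ W (F.suc j)
    cell-in-box (W<x , x<W) a≤j =
      inj₁ (≤-<-trans (W-monotone z≤n) W<x) , inj₁ (<-≤-trans x<W (W-monotone (s≤s a≤j)))

    private
      cell-inhabited : ∀ k → Σ Carrier (Cell k)
      cell-inhabited k = dense (W-increasing (inject₁ k) (F.suc k) (FP.≤̄⇒inject₁< FP.≤-refl))

    cell-point : Fin n → Carrier
    cell-point k = proj₁ (cell-inhabited k)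

    cell-point-cell : ∀ k → Cell k (cell-point k)
    cell-point-cell k = proj₂ (cell-inhabited k)

    cell-point-monotone : ∀ {a b} → a F.≤ b → cell-point a ≤ cell-point b
    cell-point-monotone {a} {b} a≤b with a F.≟ b
    ... | yes refl = inj₂ Eq.refl
    ... | no a≢b   = inj₁ (trans (proj₂ (cell-point-cell a))
                                  (cell-above (FP.≤∧≢⇒< a≤b a≢b) (cell-point-cell b)))

    module _ (π : Permutation′ n) (ρ : Fin n → Fin n) where

      meets⇒partition : Meets W π ρ → IsPartition (lam ρ π) × (∀ i → lam ρ π i F.≤ π ⟨$⟩ʳ i)
      meets⇒partition (x , box , chamber , cell) =
        (λ i j i≤j → cell-index-≤ (cell (π ⟨$⟩ʳ i)) (cell (π ⟨$⟩ʳ j)) (chamber i j i≤j)) ,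
        (λ i → cell-index-bounded (cell (π ⟨$⟩ʳ i)) (proj₂ (box (π ⟨$⟩ʳ i))))

      partition⇒meets : IsPartition (lam ρ π) × (∀ i → lam ρ π i F.≤ π ⟨$⟩ʳ i) → Meets W π ρ
      partition⇒meets (decreasing , bounded) =
        x , (λ j → cell-in-box (cell-point-cell (ρ j)) (ρ≤id j)) ,
        (λ i j i≤j → cell-point-monotone (decreasing i j i≤j)) , (λ j → cell-point-cell (ρ j))
        where
          x : Fin n → Carrier
          x j = cell-point (ρ j)

          ρ≤id : ∀ j → ρ j F.≤ j
          ρ≤id = permute-∀ π bounded

lemma3 : ∀ {c ℓ₁ ℓ₂} (O : DenseLinearOrder c ℓ₁ ℓ₂) (n : ℕ) → 1 N.≤ n →
    (W : Fin (suc n) → DenseLinearOrder.Carrier O) → Setup.StrictlyIncreasing O W →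
    (π : Permutation′ n) (ρ : Fin n → Fin n) →
    Setup.Meets O W π ρ ⇔ (IsPartition (lam ρ π) × (∀ i → lam ρ π i F.≤ π ⟨$⟩ʳ i))
lemma3 O n _ W W-increasing π ρ =
  mk⇔ (Cells.meets⇒partition O W W-increasing π ρ) (Cells.partition⇒meets O W W-increasing π ρ)
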